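{- Let $P$ be a functional Pure Type System. For terms $t$, $u$ and a variable $x$ of $P$ for which the translations below are defined: (1) $|(u/x)t|=(|u|/x)|t|$ and $\|(u/x)t\|=(|u|/x)\|t\|$; (2) if $t\longrightarrow_\beta u$ then $|t|\longrightarrow_\beta |u|$.
   Context: A Pure Type System $P=\langle S,A,R\rangle$ consists of sorts $S$, axioms $A\subseteq S\times S$, rules $R\subseteq S\times S\times S$, with the usual PTS typing rules; $P$ is functional if axioms and rules are functional relations in their first one, resp. two, components (so types of well-typed terms that are sorts are unique). $\Sigma_P$ is the $\lambda\Pi$-calculus context declaring, for each sort $s$, $U_s:Type$, $\varepsilon_s:U_s\Rightarrow Type$; for each axiom $\langle s_1,s_2\rangle$, $\dot{s_1}:U_{s_2}$; for each rule $\langle s_1,s_2,s_3\rangle$, $\dot\Pi_{\langle s_1,s_2,s_3\rangle}:\Pi X:U_{s_1}~(((\varepsilon_{s_1}~X)\Rightarrow U_{s_2})\Rightarrow U_{s_3})$. Translation of $t$ well-typed in a context $\Gamma$ of $P$: $|x|=x$; $|s|=\dot s$; $|\Pi x:A~B|=\dot\Pi_{\langle s_1,s_2,s_3\rangle}~|A|~(\lambda x:(\varepsilon_{s_1}~|A|)~|B|)$ with $s_1,s_2,s_3$ the types of $A$, $B$, $\Pi x:A~B$; $|\lambda x:A~t|=\lambda x:(\varepsilon_s~|A|)~|t|$ with $s$ the type of $A$; $|t~u|=|t|~|u|$. For $A$ of type a sort $s$, $\|A\|=\varepsilon_s~|A|$; for a non-typable sort $s'$, $\|s'\|=U_{s'}$.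 -}

module Defs where

open import Data.Nat using (ℕ; zero; suc)
open import Data.List using (List; []; _∷_; _++_; length)
open import Data.Product using (Σ; ∃; _,_)
open import Relation.Nullary using (¬_)
open import Relation.Binary.PropositionalEquality using (_≡_)
open import Relation.Binary.Construct.Closure.Equivalence using (EqClosure)
open import Relation.Binary.Construct.Closure.Transitive using (TransClosure)

record PTS : Set₁ where
  field
    Sort  : Set
    Axiom : Sort → Sort → Set
    Rule  : Sort → Sort → Sort → Set

Functional : PTS → Set
Functional P =
  (∀ {s s₁ s₂} → Axiom s s₁ → Axiom s s₂ → s₁ ≡ s₂) Data.Product.×
  (∀ {s₁ s₂ s₃ s₃'} → Rule s₁ s₂ s₃ → Rule s₁ s₂ s₃' → s₃ ≡ s₃')
  where open PTS P

-- Generic syntax with de Bruijn indices (var 0 = innermost binder),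
-- parametrised by a set C of constants.  PTS terms use C = sorts;
-- λΠ-terms use C = LConst S (Type, Kind and the constants of Σ_P).

data Term (C : Set) : Set where
  var   : ℕ → Term C
  const : C → Term C
  pi    : Term C → Term C → Term C
  lam   : Term C → Term C → Term C
  app   : Term C → Term C → Term C

module _ {C : Set} where

  ext : (ℕ → ℕ) → ℕ → ℕ
  ext ρ zero    = zero
  ext ρ (suc i) = suc (ρ i)

  ren : (ℕ → ℕ) → Term C → Term C
  ren ρ (var i)   = var (ρ i)
  ren ρ (const c) = const c
  ren ρ (pi A B)  = pi (ren ρ A) (ren (ext ρ) B)
  ren ρ (lam A t) = lam (ren ρ A) (ren (ext ρ) t)
  ren ρ (app t u) = app (ren ρ t) (ren ρ u)

  exts : (ℕ → Term C) → ℕ → Term C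
  exts σ zero    = var zero
  exts σ (suc i) = ren suc (σ i)

  sub : (ℕ → Term C) → Term C → Term C
  sub σ (var i)   = σ i
  sub σ (const c) = const c
  sub σ (pi A B)  = pi (sub σ A) (sub (exts σ) B)
  sub σ (lam A t) = lam (sub σ A) (sub (exts σ) t)
  sub σ (app t u) = app (sub σ t) (sub σ u)

  -- substitution of u for the variable of index k, where u lives in the
  -- context below that variable: var k ↦ u shifted by k, var i ↦ var i
  -- for i < k, var i ↦ var (i - 1) for i > k.
  subAt : ℕ → Term C → ℕ → Term C
  subAt zero    u zero    = u
  subAt zero    u (suc i) = var i
  subAt (suc k) u zero    = var zero
  subAt (suc k) u (suc i) = ren suc (subAt k u i)

  _[_≔_] : Term C → ℕ → Term C → Term C
  t [ k ≔ u ] = sub (subAt k u) t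

  data _⟶β_ : Term C → Term C → Set where
    β     : ∀ {A t u} → app (lam A t) u ⟶β (t [ 0 ≔ u ])
    piˡ   : ∀ {A A' B} → A ⟶β A' → pi A B ⟶β pi A' B
    piʳ   : ∀ {A B B'} → B ⟶β B' → pi A B ⟶β pi A B'
    lamˡ  : ∀ {A A' t} → A ⟶β A' → lam A t ⟶β lam A' t
    lamʳ  : ∀ {A t t'} → t ⟶β t' → lam A t ⟶β lam A t'
    appˡ  : ∀ {t t' u} → t ⟶β t' → app t u ⟶β app t' u
    appʳ  : ∀ {t u u'} → u ⟶β u' → app t u ⟶β app t u'

  _≡β_ : Term C → Term C → Set
  _≡β_ = EqClosure _⟶β_

  _⟶β⁺_ : Term C → Term C → Set
  _⟶β⁺_ = TransClosure _⟶β_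

-- Typing in a PTS (Barendregt's formulation).  Contexts are lists of
-- types, head = type of var 0; each entry lives in the context after it.

module _ (P : PTS) where
  open PTS P

  PTerm : Set
  PTerm = Term Sort

  Ctx : Set
  Ctx = List PTerm

  sort : Sort → PTerm
  sort = const

  data _⊢_∶_ : Ctx → PTerm → PTerm → Set where
    axiom : ∀ {s₁ s₂} → Axiom s₁ s₂ → [] ⊢ sort s₁ ∶ sort s₂
    start : ∀ {Γ A s} → Γ ⊢ A ∶ sort s → (A ∷ Γ) ⊢ var 0 ∶ ren suc A
    weak  : ∀ {Γ A s t T} → Γ ⊢ t ∶ T → Γ ⊢ A ∶ sort s →
            (A ∷ Γ) ⊢ ren suc t ∶ ren suc T
    prod  : ∀ {Γ A B s₁ s₂ s₃} → Rule s₁ s₂ s₃ →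
            Γ ⊢ A ∶ sort s₁ → (A ∷ Γ) ⊢ B ∶ sort s₂ →
            Γ ⊢ pi A B ∶ sort s₃
    abs   : ∀ {Γ A B t s} → (A ∷ Γ) ⊢ t ∶ B → Γ ⊢ pi A B ∶ sort s →
            Γ ⊢ lam A t ∶ pi A B
    appl  : ∀ {Γ A B t u} → Γ ⊢ t ∶ pi A B → Γ ⊢ u ∶ A →
            Γ ⊢ app t u ∶ (B [ 0 ≔ u ])
    conv  : ∀ {Γ A B t s} → Γ ⊢ t ∶ A → Γ ⊢ B ∶ sort s → A ≡β B →
            Γ ⊢ t ∶ B

  -- Δ[u/x] for the context Γ, x:A, Δ  (Δ written innermost-first)
  substCtx : Ctx → PTerm → Ctx
  substCtx []      u = []
  substCtx (D ∷ Δ) u = (D [ length Δ ≔ u ]) ∷ substCtx Δ u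

data LConst (S : Set) : Set where
  Type Kind : LConst S
  U ε dot   : S → LConst S
  dotΠ      : S → S → S → LConst S

module _ (P : PTS) where
  open PTS P

  LTerm : Set
  LTerm = Term (LConst Sort)

  -- |t| (relative to the context Γ): Tr Γ t t' means "|t| = t'"
  data Tr : Ctx P → PTerm P → LTerm → Set where
    tr-var  : ∀ {Γ i} → Tr Γ (var i) (var i)
    tr-sort : ∀ {Γ s} → Tr Γ (const s) (const (dot s))
    tr-pi   : ∀ {Γ A B A' B' s₁ s₂ s₃} →
              _⊢_∶_ P Γ A (const s₁) → _⊢_∶_ P (A ∷ Γ) B (const s₂) →
              _⊢_∶_ P Γ (pi A B) (const s₃) →
              Tr Γ A A' → Tr (A ∷ Γ) B B' →
              Tr Γ (pi A B)
                 (app (app (const (dotΠ s₁ s₂ s₃)) A')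
                      (lam (app (const (ε s₁)) A') B'))
    tr-lam  : ∀ {Γ A t A' t' s} →
              _⊢_∶_ P Γ A (const s) →
              Tr Γ A A' → Tr (A ∷ Γ) t t' →
              Tr Γ (lam A t) (lam (app (const (ε s)) A') t')
    tr-app  : ∀ {Γ t u t' u'} → Tr Γ t t' → Tr Γ u u' →
              Tr Γ (app t u) (app t' u')

  -- ‖A‖ (relative to Γ): Tr₂ Γ A A' means "‖A‖ = A'"
  data Tr₂ : Ctx P → PTerm P → LTerm → Set where
    tr₂-typ : ∀ {Γ A A' s} → _⊢_∶_ P Γ A (const s) → Tr Γ A A' →
              Tr₂ Γ A (app (const (ε s)) A')
    tr₂-top : ∀ {Γ s'} → ¬ (∃ λ s'' → Axiom s' s'') →
              Tr₂ Γ (const s') (const (U s'))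

-- The translation is syntax-directed once the sorts of the subterms are fixed, and in a
-- functional PTS these sorts are unique: types are unique up to β-conversion, and by
-- Church–Rosser two convertible sorts are equal.  Hence the translation is a deterministic
-- relation, and both claims reduce to exhibiting one translation of the substituted or
-- reduced term.  For substitution this is the substitution lemma for typing, which keeps
-- every sort annotation valid; for β it is subject reduction, together with the fact that
-- |λx:A.t| is again a λ-abstraction, so a redex translates to a redex.

module Submission where

open import Defs
open import Data.List using ([]; _∷_; _++_; length)
open import Data.Nat using (ℕ; zero; suc)
open import Data.Product using (∃; ∃₂; _×_; _,_; proj₁; proj₂)
open import Data.Empty using (⊥-elim)
open import Data.Sum using (_⊎_; inj₁; inj₂)
open import Function using (_∘_)
open import Relation.Binary.PropositionalEquality
  using (_≡_; _≗_; refl; sym; trans; cong; cong₂; subst; subst₂; module ≡-Reasoning)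
open import Relation.Binary.Construct.Closure.ReflexiveTransitive using (Star; ε; _◅_; _◅◅_)
open import Relation.Binary.Construct.Closure.Symmetric using (fwd; bwd)
open import Relation.Binary.Construct.Closure.Transitive using ([_]; _∷_)
  renaming (_++_ to _⁺++⁺_)
import Relation.Binary.Construct.Closure.ReflexiveTransitive as Star
import Relation.Binary.Construct.Closure.Equivalence as EqClosure

module _ {C : Set} where

  ext-cong : ∀ {ρ ρ' : ℕ → ℕ} → ρ ≗ ρ' → ext {C} ρ ≗ ext {C} ρ'
  ext-cong h zero    = refl
  ext-cong h (suc i) = cong suc (h i)

  ext-∘ : ∀ (ρ ρ' : ℕ → ℕ) → ext {C} ρ ∘ ext {C} ρ' ≗ ext {C} (ρ ∘ ρ')
  ext-∘ ρ ρ' zero    = refl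
  ext-∘ ρ ρ' (suc i) = refl

  ren-cong : ∀ {ρ ρ' : ℕ → ℕ} → ρ ≗ ρ' → (t : Term C) → ren ρ t ≡ ren ρ' t
  ren-cong h (var i)   = cong var (h i)
  ren-cong h (const c) = refl
  ren-cong h (pi A B)  = cong₂ pi (ren-cong h A) (ren-cong (ext-cong h) B)
  ren-cong h (lam A t) = cong₂ lam (ren-cong h A) (ren-cong (ext-cong h) t)
  ren-cong h (app t u) = cong₂ app (ren-cong h t) (ren-cong h u)

  ren-ren : ∀ (ρ ρ' : ℕ → ℕ) (t : Term C) → ren ρ (ren ρ' t) ≡ ren (ρ ∘ ρ') t
  ren-ren ρ ρ' (var i)   = refl
  ren-ren ρ ρ' (const c) = refl
  ren-ren ρ ρ' (pi A B)  =
    cong₂ pi (ren-ren ρ ρ' A) (trans (ren-ren (ext {C} ρ) (ext {C} ρ') B) (ren-cong (ext-∘ ρ ρ') B))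
  ren-ren ρ ρ' (lam A t) =
    cong₂ lam (ren-ren ρ ρ' A) (trans (ren-ren (ext {C} ρ) (ext {C} ρ') t) (ren-cong (ext-∘ ρ ρ') t))
  ren-ren ρ ρ' (app t u) = cong₂ app (ren-ren ρ ρ' t) (ren-ren ρ ρ' u)

  ren-ext-suc : ∀ (ρ : ℕ → ℕ) (t : Term C) → ren (ext {C} ρ) (ren suc t) ≡ ren suc (ren ρ t)
  ren-ext-suc ρ t = trans (ren-ren (ext {C} ρ) suc t) (sym (ren-ren suc ρ t))

  exts-cong : ∀ {σ τ : ℕ → Term C} → σ ≗ τ → exts σ ≗ exts τ
  exts-cong h zero    = refl
  exts-cong h (suc i) = cong (ren suc) (h i)

  sub-cong : ∀ {σ τ : ℕ → Term C} → σ ≗ τ → (t : Term C) → sub σ t ≡ sub τ t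
  sub-cong h (var i)   = h i
  sub-cong h (const c) = refl
  sub-cong h (pi A B)  = cong₂ pi (sub-cong h A) (sub-cong (exts-cong h) B)
  sub-cong h (lam A t) = cong₂ lam (sub-cong h A) (sub-cong (exts-cong h) t)
  sub-cong h (app t u) = cong₂ app (sub-cong h t) (sub-cong h u)

  exts-ext : ∀ (σ : ℕ → Term C) (ρ : ℕ → ℕ) → exts σ ∘ ext {C} ρ ≗ exts (σ ∘ ρ)
  exts-ext σ ρ zero    = refl
  exts-ext σ ρ (suc i) = refl

  sub-ren : ∀ (σ : ℕ → Term C) (ρ : ℕ → ℕ) (t : Term C) → sub σ (ren ρ t) ≡ sub (σ ∘ ρ) t
  sub-ren σ ρ (var i)   = refl
  sub-ren σ ρ (const c) = refl
  sub-ren σ ρ (pi A B)  =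
    cong₂ pi (sub-ren σ ρ A) (trans (sub-ren (exts σ) (ext {C} ρ) B) (sub-cong (exts-ext σ ρ) B))
  sub-ren σ ρ (lam A t) =
    cong₂ lam (sub-ren σ ρ A) (trans (sub-ren (exts σ) (ext {C} ρ) t) (sub-cong (exts-ext σ ρ) t))
  sub-ren σ ρ (app t u) = cong₂ app (sub-ren σ ρ t) (sub-ren σ ρ u)

  ren-exts : ∀ (ρ : ℕ → ℕ) (σ : ℕ → Term C) → ren (ext {C} ρ) ∘ exts σ ≗ exts (ren ρ ∘ σ)
  ren-exts ρ σ zero    = refl
  ren-exts ρ σ (suc i) = ren-ext-suc ρ (σ i)

  ren-sub : ∀ (ρ : ℕ → ℕ) (σ : ℕ → Term C) (t : Term C) → ren ρ (sub σ t) ≡ sub (ren ρ ∘ σ) t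
  ren-sub ρ σ (var i)   = refl
  ren-sub ρ σ (const c) = refl
  ren-sub ρ σ (pi A B)  =
    cong₂ pi (ren-sub ρ σ A) (trans (ren-sub (ext {C} ρ) (exts σ) B) (sub-cong (ren-exts ρ σ) B))
  ren-sub ρ σ (lam A t) =
    cong₂ lam (ren-sub ρ σ A) (trans (ren-sub (ext {C} ρ) (exts σ) t) (sub-cong (ren-exts ρ σ) t))
  ren-sub ρ σ (app t u) = cong₂ app (ren-sub ρ σ t) (ren-sub ρ σ u)

  sub-exts-suc : ∀ (σ : ℕ → Term C) (t : Term C) → sub (exts σ) (ren suc t) ≡ ren suc (sub σ t)
  sub-exts-suc σ t = trans (sub-ren (exts σ) suc t) (sym (ren-sub suc σ t))

  sub-exts : ∀ (σ τ : ℕ → Term C) → sub (exts σ) ∘ exts τ ≗ exts (sub σ ∘ τ)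
  sub-exts σ τ zero    = refl
  sub-exts σ τ (suc i) = sub-exts-suc σ (τ i)

  sub-sub : ∀ (σ τ : ℕ → Term C) (t : Term C) → sub σ (sub τ t) ≡ sub (sub σ ∘ τ) t
  sub-sub σ τ (var i)   = refl
  sub-sub σ τ (const c) = refl
  sub-sub σ τ (pi A B)  =
    cong₂ pi (sub-sub σ τ A) (trans (sub-sub (exts σ) (exts τ) B) (sub-cong (sub-exts σ τ) B))
  sub-sub σ τ (lam A t) =
    cong₂ lam (sub-sub σ τ A) (trans (sub-sub (exts σ) (exts τ) t) (sub-cong (sub-exts σ τ) t))
  sub-sub σ τ (app t u) = cong₂ app (sub-sub σ τ t) (sub-sub σ τ u)

  exts-var∘ : ∀ (ρ : ℕ → ℕ) → exts {C} (var ∘ ρ) ≗ var ∘ ext {C} ρ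
  exts-var∘ ρ zero    = refl
  exts-var∘ ρ (suc i) = refl

  sub-var∘ : ∀ (ρ : ℕ → ℕ) (t : Term C) → sub (var ∘ ρ) t ≡ ren ρ t
  sub-var∘ ρ (var i)   = refl
  sub-var∘ ρ (const c) = refl
  sub-var∘ ρ (pi A B)  =
    cong₂ pi (sub-var∘ ρ A) (trans (sub-cong (exts-var∘ ρ) B) (sub-var∘ (ext {C} ρ) B))
  sub-var∘ ρ (lam A t) =
    cong₂ lam (sub-var∘ ρ A) (trans (sub-cong (exts-var∘ ρ) t) (sub-var∘ (ext {C} ρ) t))
  sub-var∘ ρ (app t u) = cong₂ app (sub-var∘ ρ t) (sub-var∘ ρ u)

  exts-var : exts {C} var ≗ var
  exts-var zero    = refl
  exts-var (suc i) = refl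

  sub-var : (t : Term C) → sub var t ≡ t
  sub-var (var i)   = refl
  sub-var (const c) = refl
  sub-var (pi A B)  = cong₂ pi (sub-var A) (trans (sub-cong exts-var B) (sub-var B))
  sub-var (lam A t) = cong₂ lam (sub-var A) (trans (sub-cong exts-var t) (sub-var t))
  sub-var (app t u) = cong₂ app (sub-var t) (sub-var u)

  ren-suc-[0≔] : (t u : Term C) → (ren suc t) [ 0 ≔ u ] ≡ t
  ren-suc-[0≔] t u = trans (sub-ren (subAt 0 u) suc t) (sub-var t)

  sub-[0≔] : ∀ (σ : ℕ → Term C) (t u : Term C) →
             sub σ (t [ 0 ≔ u ]) ≡ (sub (exts σ) t) [ 0 ≔ sub σ u ]
  sub-[0≔] σ t u = begin
    sub σ (t [ 0 ≔ u ])                          ≡⟨ sub-sub σ (subAt 0 u) t ⟩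
    sub (sub σ ∘ subAt 0 u) t                     ≡⟨ sub-cong pointwise t ⟩
    sub (sub (subAt 0 (sub σ u)) ∘ exts σ) t      ≡⟨ sub-sub (subAt 0 (sub σ u)) (exts σ) t ⟨
    (sub (exts σ) t) [ 0 ≔ sub σ u ]              ∎
    where
    open ≡-Reasoning
    pointwise : sub σ ∘ subAt 0 u ≗ sub (subAt 0 (sub σ u)) ∘ exts σ
    pointwise zero    = refl
    pointwise (suc i) = sym (ren-suc-[0≔] (σ i) (sub σ u))

  ren-[0≔] : ∀ (ρ : ℕ → ℕ) (t u : Term C) →
             ren ρ (t [ 0 ≔ u ]) ≡ (ren (ext {C} ρ) t) [ 0 ≔ ren ρ u ]
  ren-[0≔] ρ t u = begin
    ren ρ (t [ 0 ≔ u ])                             ≡⟨ sub-var∘ ρ _ ⟨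
    sub (var ∘ ρ) (t [ 0 ≔ u ])                     ≡⟨ sub-[0≔] (var ∘ ρ) t u ⟩
    (sub (exts (var ∘ ρ)) t) [ 0 ≔ sub (var ∘ ρ) u ] ≡⟨ cong₂ _[ 0 ≔_] lifted (sub-var∘ ρ u) ⟩
    (ren (ext {C} ρ) t) [ 0 ≔ ren ρ u ]                 ∎
    where
    open ≡-Reasoning
    lifted : sub (exts (var ∘ ρ)) t ≡ ren (ext {C} ρ) t
    lifted = trans (sub-cong (exts-var∘ ρ) t) (sub-var∘ (ext {C} ρ) t)

module _ {C : Set} where

  infix 4 _⟶β*_
  _⟶β*_ : Term C → Term C → Set
  _⟶β*_ = Star _⟶β_

  ⟶β-sub : ∀ (σ : ℕ → Term C) {t t'} → t ⟶β t' → sub σ t ⟶β sub σ t'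
  ⟶β-sub σ (β {A} {t} {u}) =
    subst (app (lam (sub σ A) (sub (exts σ) t)) (sub σ u) ⟶β_) (sym (sub-[0≔] σ t u)) β
  ⟶β-sub σ (piˡ r)  = piˡ (⟶β-sub σ r)
  ⟶β-sub σ (piʳ r)  = piʳ (⟶β-sub (exts σ) r)
  ⟶β-sub σ (lamˡ r) = lamˡ (⟶β-sub σ r)
  ⟶β-sub σ (lamʳ r) = lamʳ (⟶β-sub (exts σ) r)
  ⟶β-sub σ (appˡ r) = appˡ (⟶β-sub σ r)
  ⟶β-sub σ (appʳ r) = appʳ (⟶β-sub σ r)

  ≡β-sub : ∀ (σ : ℕ → Term C) {t t'} → t ≡β t' → sub σ t ≡β sub σ t'
  ≡β-sub σ = EqClosure.gmap (sub σ) (⟶β-sub σ)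

  ≡β-ren : ∀ (ρ : ℕ → ℕ) {t t' : Term C} → t ≡β t' → ren ρ t ≡β ren ρ t'
  ≡β-ren ρ {t} {t'} e = subst₂ _≡β_ (sub-var∘ ρ t) (sub-var∘ ρ t') (≡β-sub (var ∘ ρ) e)

  ≡β-sym : ∀ {t t' : Term C} → t ≡β t' → t' ≡β t
  ≡β-sym = EqClosure.symmetric _⟶β_

  ⟶β⇒≡β : ∀ {t t' : Term C} → t ⟶β t' → t ≡β t'
  ⟶β⇒≡β = EqClosure.return

  ⟶β*⇒≡β : ∀ {t t' : Term C} → t ⟶β* t' → t ≡β t'
  ⟶β*⇒≡β = Star.map fwd

  pi-≡βˡ : ∀ {A A' B : Term C} → A ≡β A' → pi A B ≡β pi A' B
  pi-≡βˡ {B = B} = EqClosure.gmap (λ A → pi A B) piˡ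

  pi-≡βʳ : ∀ {A B B' : Term C} → B ≡β B' → pi A B ≡β pi A B'
  pi-≡βʳ {A = A} = EqClosure.gmap (pi A) piʳ

  ren-⟶β-inv : ∀ (ρ : ℕ → ℕ) (t : Term C) {w} → ren ρ t ⟶β w →
               ∃ λ t' → t ⟶β t' × w ≡ ren ρ t'
  ren-⟶β-inv ρ (pi A B) (piˡ r) with ren-⟶β-inv ρ A r
  ... | _ , r' , refl = _ , piˡ r' , refl
  ren-⟶β-inv ρ (pi A B) (piʳ r) with ren-⟶β-inv (ext {C} ρ) B r
  ... | _ , r' , refl = _ , piʳ r' , refl
  ren-⟶β-inv ρ (lam A t) (lamˡ r) with ren-⟶β-inv ρ A r
  ... | _ , r' , refl = _ , lamˡ r' , refl
  ren-⟶β-inv ρ (lam A t) (lamʳ r) with ren-⟶β-inv (ext {C} ρ) t r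
  ... | _ , r' , refl = _ , lamʳ r' , refl
  ren-⟶β-inv ρ (app (lam A t) u) β = _ , β , sym (ren-[0≔] ρ t u)
  ren-⟶β-inv ρ (app t u) (appˡ r) with ren-⟶β-inv ρ t r
  ... | _ , r' , refl = _ , appˡ r' , refl
  ren-⟶β-inv ρ (app t u) (appʳ r) with ren-⟶β-inv ρ u r
  ... | _ , r' , refl = _ , appʳ r' , refl

  infix 4 _⇛_ _⇛*_
  data _⇛_ : Term C → Term C → Set where
    ⇛-var   : ∀ {i} → var i ⇛ var i
    ⇛-const : ∀ {c} → const c ⇛ const c
    ⇛-pi    : ∀ {A A' B B'} → A ⇛ A' → B ⇛ B' → pi A B ⇛ pi A' B'
    ⇛-lam   : ∀ {A A' t t'} → A ⇛ A' → t ⇛ t' → lam A t ⇛ lam A' t'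
    ⇛-app   : ∀ {t t' u u'} → t ⇛ t' → u ⇛ u' → app t u ⇛ app t' u'
    ⇛-β     : ∀ {A t t' u u'} → t ⇛ t' → u ⇛ u' → app (lam A t) u ⇛ (t' [ 0 ≔ u' ])

  _⇛*_ : Term C → Term C → Set
  _⇛*_ = Star _⇛_

  ⇛-refl : ∀ t → t ⇛ t
  ⇛-refl (var i)   = ⇛-var
  ⇛-refl (const c) = ⇛-const
  ⇛-refl (pi A B)  = ⇛-pi (⇛-refl A) (⇛-refl B)
  ⇛-refl (lam A t) = ⇛-lam (⇛-refl A) (⇛-refl t)
  ⇛-refl (app t u) = ⇛-app (⇛-refl t) (⇛-refl u)

  ⟶β⇒⇛ : ∀ {t t'} → t ⟶β t' → t ⇛ t'
  ⟶β⇒⇛ (β {t = t} {u}) = ⇛-β (⇛-refl t) (⇛-refl u)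
  ⟶β⇒⇛ (piˡ r)  = ⇛-pi (⟶β⇒⇛ r) (⇛-refl _)
  ⟶β⇒⇛ (piʳ r)  = ⇛-pi (⇛-refl _) (⟶β⇒⇛ r)
  ⟶β⇒⇛ (lamˡ r) = ⇛-lam (⟶β⇒⇛ r) (⇛-refl _)
  ⟶β⇒⇛ (lamʳ r) = ⇛-lam (⇛-refl _) (⟶β⇒⇛ r)
  ⟶β⇒⇛ (appˡ r) = ⇛-app (⟶β⇒⇛ r) (⇛-refl _)
  ⟶β⇒⇛ (appʳ r) = ⇛-app (⇛-refl _) (⟶β⇒⇛ r)

  ⇛⇒⟶β* : ∀ {t t'} → t ⇛ t' → t ⟶β* t'
  ⇛⇒⟶β* ⇛-var   = ε
  ⇛⇒⟶β* ⇛-const = ε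
  ⇛⇒⟶β* (⇛-pi {A} {A'} {B} a b) =
    Star.gmap (λ X → pi X B) piˡ (⇛⇒⟶β* a) ◅◅ Star.gmap (pi A') piʳ (⇛⇒⟶β* b)
  ⇛⇒⟶β* (⇛-lam {A} {A'} {t} a b) =
    Star.gmap (λ X → lam X t) lamˡ (⇛⇒⟶β* a) ◅◅ Star.gmap (lam A') lamʳ (⇛⇒⟶β* b)
  ⇛⇒⟶β* (⇛-app {t} {t'} {u} a b) =
    Star.gmap (λ X → app X u) appˡ (⇛⇒⟶β* a) ◅◅ Star.gmap (app t') appʳ (⇛⇒⟶β* b)
  ⇛⇒⟶β* (⇛-β {A} {t} {t'} {u} a b) =
    Star.gmap (λ X → app (lam A X) u) (appˡ ∘ lamʳ) (⇛⇒⟶β* a) ◅◅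
    Star.gmap (app (lam A t')) appʳ (⇛⇒⟶β* b) ◅◅ β ◅ ε

  ⇛*⇒⟶β* : ∀ {t t'} → t ⇛* t' → t ⟶β* t'
  ⇛*⇒⟶β* ε        = ε
  ⇛*⇒⟶β* (p ◅ ps) = ⇛⇒⟶β* p ◅◅ ⇛*⇒⟶β* ps

  ⇛-ren : ∀ (ρ : ℕ → ℕ) {t t'} → t ⇛ t' → ren ρ t ⇛ ren ρ t'
  ⇛-ren ρ ⇛-var       = ⇛-var
  ⇛-ren ρ ⇛-const     = ⇛-const
  ⇛-ren ρ (⇛-pi a b)  = ⇛-pi (⇛-ren ρ a) (⇛-ren (ext {C} ρ) b)
  ⇛-ren ρ (⇛-lam a b) = ⇛-lam (⇛-ren ρ a) (⇛-ren (ext {C} ρ) b)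
  ⇛-ren ρ (⇛-app a b) = ⇛-app (⇛-ren ρ a) (⇛-ren ρ b)
  ⇛-ren ρ (⇛-β {A} {t} {t'} {u} {u'} a b) =
    subst (ren ρ (app (lam A t) u) ⇛_) (sym (ren-[0≔] ρ t' u'))
      (⇛-β (⇛-ren (ext {C} ρ) a) (⇛-ren ρ b))

  ⇛-exts : ∀ {σ τ : ℕ → Term C} → (∀ i → σ i ⇛ τ i) → ∀ i → exts σ i ⇛ exts τ i
  ⇛-exts h zero    = ⇛-var
  ⇛-exts h (suc i) = ⇛-ren suc (h i)

  ⇛-sub : ∀ {σ τ : ℕ → Term C} → (∀ i → σ i ⇛ τ i) → ∀ {t t'} → t ⇛ t' → sub σ t ⇛ sub τ t'
  ⇛-sub h ⇛-var       = h _
  ⇛-sub h ⇛-const     = ⇛-const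
  ⇛-sub h (⇛-pi a b)  = ⇛-pi (⇛-sub h a) (⇛-sub (⇛-exts h) b)
  ⇛-sub h (⇛-lam a b) = ⇛-lam (⇛-sub h a) (⇛-sub (⇛-exts h) b)
  ⇛-sub h (⇛-app a b) = ⇛-app (⇛-sub h a) (⇛-sub h b)
  ⇛-sub {σ} {τ} h (⇛-β {A} {t} {t'} {u} {u'} a b) =
    subst (sub σ (app (lam A t) u) ⇛_) (sym (sub-[0≔] τ t' u'))
      (⇛-β (⇛-sub (⇛-exts h) a) (⇛-sub h b))

  ⇛-[0≔] : ∀ {t t' u u' : Term C} → t ⇛ t' → u ⇛ u' → (t [ 0 ≔ u ]) ⇛ (t' [ 0 ≔ u' ])
  ⇛-[0≔] a b = ⇛-sub (λ { zero → b ; (suc i) → ⇛-var }) a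

  develop : Term C → Term C
  develop (var i)           = var i
  develop (const c)         = const c
  develop (pi A B)          = pi (develop A) (develop B)
  develop (lam A t)         = lam (develop A) (develop t)
  develop (app (lam A t) u) = develop t [ 0 ≔ develop u ]
  develop (app t u)         = app (develop t) (develop u)

  -- Takahashi's triangle property: confluence of ⇛ follows without a diamond lemma.
  ⇛-develop : ∀ {t t'} → t ⇛ t' → t' ⇛ develop t
  ⇛-develop ⇛-var       = ⇛-var
  ⇛-develop ⇛-const     = ⇛-const
  ⇛-develop (⇛-pi a b)  = ⇛-pi (⇛-develop a) (⇛-develop b)
  ⇛-develop (⇛-lam a b) = ⇛-lam (⇛-develop a) (⇛-develop b)
  ⇛-develop (⇛-app {var _} a b)   = ⇛-app (⇛-develop a) (⇛-develop b)
  ⇛-develop (⇛-app {const _} a b) = ⇛-app (⇛-develop a) (⇛-develop b)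
  ⇛-develop (⇛-app {pi _ _} a b)  = ⇛-app (⇛-develop a) (⇛-develop b)
  ⇛-develop (⇛-app {app _ _} a b) = ⇛-app (⇛-develop a) (⇛-develop b)
  ⇛-develop (⇛-app {lam _ _} (⇛-lam a₁ a₂) b) = ⇛-β (⇛-develop a₂) (⇛-develop b)
  ⇛-develop (⇛-β a b)   = ⇛-[0≔] (⇛-develop a) (⇛-develop b)

  ⇛-strip : ∀ {a b c} → a ⇛ b → a ⇛* c → ∃ λ d → b ⇛* d × c ⇛ d
  ⇛-strip ab ε        = _ , ε , ab
  ⇛-strip ab (ac ◅ cs) with ⇛-strip (⇛-develop ac) cs
  ... | d , bd , cd = d , ⇛-develop ab ◅ bd , cd

  church-rosser : ∀ {a b : Term C} → a ≡β b → ∃ λ c → a ⟶β* c × b ⟶β* c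
  church-rosser ε = _ , ε , ε
  church-rosser (fwd r ◅ rs) with church-rosser rs
  ... | c , a₁c , bc = c , r ◅ a₁c , bc
  church-rosser (bwd r ◅ rs) with church-rosser rs
  ... | c , a₁c , bc with ⇛-strip (⟶β⇒⇛ r) (Star.map ⟶β⇒⇛ a₁c)
  ... | d , ad , cd = d , ⇛*⇒⟶β* ad , bc ◅◅ ⇛⇒⟶β* cd

  const-⟶β* : ∀ {c : C} {X} → const c ⟶β* X → X ≡ const c
  const-⟶β* ε = refl
  const-⟶β* (() ◅ _)

  pi-⟶β* : ∀ {A B X : Term C} → pi A B ⟶β* X →
           ∃₂ λ A' B' → X ≡ pi A' B' × A ⟶β* A' × B ⟶β* B'
  pi-⟶β* ε = _ , _ , refl , ε , ε
  pi-⟶β* (piˡ r ◅ rs) with pi-⟶β* rs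
  ... | _ , _ , refl , a , b = _ , _ , refl , r ◅ a , b
  pi-⟶β* (piʳ r ◅ rs) with pi-⟶β* rs
  ... | _ , _ , refl , a , b = _ , _ , refl , a , r ◅ b

  const-≡β-injective : ∀ {c c' : C} → const c ≡β const c' → c ≡ c'
  const-≡β-injective e with church-rosser e
  ... | _ , r , r' with trans (sym (const-⟶β* r)) (const-⟶β* r')
  ... | refl = refl

  pi-≡β-injective : ∀ {A B A' B' : Term C} → pi A B ≡β pi A' B' → A ≡β A' × B ≡β B'
  pi-≡β-injective e with church-rosser e
  ... | _ , r , r' with pi-⟶β* r | pi-⟶β* r'
  ... | _ , _ , refl , a , b | _ , _ , refl , a' , b' =
    ⟶β*⇒≡β a ◅◅ ≡β-sym (⟶β*⇒≡β a') , ⟶β*⇒≡β b ◅◅ ≡β-sym (⟶β*⇒≡β b')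

  [0≔]-≡β : ∀ (B : Term C) {u u'} → u ⟶β u' → (B [ 0 ≔ u' ]) ≡β (B [ 0 ≔ u ])
  [0≔]-≡β B r = ≡β-sym (⟶β*⇒≡β (⇛⇒⟶β* (⇛-[0≔] (⇛-refl B) (⟶β⇒⇛ r))))

  ⟶β⁺-map : ∀ {D : Set} (f : Term C → Term D) → (∀ {a b} → a ⟶β b → f a ⟶β f b) →
            ∀ {a b} → a ⟶β⁺ b → f a ⟶β⁺ f b
  ⟶β⁺-map f g [ r ]    = [ g r ]
  ⟶β⁺-map f g (r ∷ rs) = g r ∷ ⟶β⁺-map f g rs

module Metatheory (P : PTS) where
  open PTS P

  infix 4 _⊢_⦂_ _∋_⦂_ _⊩_⦂_
  _⊢_⦂_ : Ctx P → PTerm P → PTerm P → Set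
  _⊢_⦂_ = _⊢_∶_ P

  data _∋_⦂_ : Ctx P → ℕ → PTerm P → Set where
    here  : ∀ {A Γ} → (A ∷ Γ) ∋ 0 ⦂ ren suc A
    there : ∀ {A Γ i T} → Γ ∋ i ⦂ T → (A ∷ Γ) ∋ suc i ⦂ ren suc T

  ∋-functional : ∀ {Γ i T T'} → Γ ∋ i ⦂ T → Γ ∋ i ⦂ T' → T ≡ T'
  ∋-functional here      here       = refl
  ∋-functional (there l) (there l') = cong (ren suc) (∋-functional l l')

  data WellFormed : Ctx P → Set where
    wf-[] : WellFormed []
    wf-∷  : ∀ {Γ A s} → Γ ⊢ A ⦂ const s → WellFormed (A ∷ Γ)

  ⊢⇒wf : ∀ {Γ t T} → Γ ⊢ t ⦂ T → WellFormed Γ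
  ⊢⇒wf (axiom _)    = wf-[]
  ⊢⇒wf (start d)    = wf-∷ d
  ⊢⇒wf (weak _ e)   = wf-∷ e
  ⊢⇒wf (prod _ a _) = ⊢⇒wf a
  ⊢⇒wf (abs _ e)    = ⊢⇒wf e
  ⊢⇒wf (appl d _)   = ⊢⇒wf d
  ⊢⇒wf (conv d _ _) = ⊢⇒wf d

  ⊢-axiom : ∀ {Γ s₁ s₂} → WellFormed Γ → Axiom s₁ s₂ → Γ ⊢ const s₁ ⦂ const s₂
  ⊢-axiom wf-[]     ax = axiom ax
  ⊢-axiom (wf-∷ d) ax = weak (⊢-axiom (⊢⇒wf d) ax) d

  ⊢-var : ∀ {Γ i T} → WellFormed Γ → Γ ∋ i ⦂ T → Γ ⊢ var i ⦂ T
  ⊢-var (wf-∷ d) here      = start d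
  ⊢-var (wf-∷ d) (there l) = weak (⊢-var (⊢⇒wf d) l) d

  record _⊩_⦂_ (Γ' : Ctx P) (σ : ℕ → PTerm P) (Γ : Ctx P) : Set where
    field
      wf     : WellFormed Γ'
      lookup : ∀ {i T} → Γ ∋ i ⦂ T → Γ' ⊢ σ i ⦂ sub σ T
  open _⊩_⦂_

  ⊩-cong : ∀ {Γ Γ' σ τ} → σ ≗ τ → Γ' ⊩ σ ⦂ Γ → Γ' ⊩ τ ⦂ Γ
  wf     (⊩-cong eq h) = wf h
  lookup (⊩-cong eq h) {i} {T} l = subst₂ (_ ⊢_⦂_) (eq i) (sub-cong eq T) (lookup h l)

  ⊩-exts : ∀ {Γ Γ' σ A s} → Γ' ⊩ σ ⦂ Γ → Γ' ⊢ sub σ A ⦂ const s →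
           (sub σ A ∷ Γ') ⊩ exts σ ⦂ (A ∷ Γ)
  wf     (⊩-exts h d) = wf-∷ d
  lookup (⊩-exts {Γ' = Γ'} {σ} {A} h d) here =
    subst ((sub σ A ∷ Γ') ⊢ var 0 ⦂_) (sym (sub-exts-suc σ A)) (start d)
  lookup (⊩-exts {Γ' = Γ'} {σ} {A} h d) (there {i = i} {T = T} l) =
    subst ((sub σ A ∷ Γ') ⊢ ren suc (σ i) ⦂_) (sym (sub-exts-suc σ T)) (weak (lookup h l) d)

  ⊩-tail : ∀ {Γ Γ' σ A} → Γ' ⊩ σ ⦂ (A ∷ Γ) → Γ' ⊩ σ ∘ suc ⦂ Γ
  wf     (⊩-tail h) = wf h
  lookup (⊩-tail {σ = σ} h) {T = T} l = subst (_ ⊢ _ ⦂_) (sub-ren σ suc T) (lookup h (there l))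

  gen-pi-domain : ∀ {Γ t T A B} → Γ ⊢ t ⦂ T → t ≡ pi A B → ∃ λ s → Γ ⊢ A ⦂ const s
  gen-pi-domain (weak {t = pi _ _} d e) refl with gen-pi-domain d refl
  ... | s , a = s , weak a e
  gen-pi-domain (prod _ a _) refl = _ , a
  gen-pi-domain (conv d _ _) eq   = gen-pi-domain d eq

  ⊢-sub : ∀ {Γ Γ' σ t T} → Γ' ⊩ σ ⦂ Γ → Γ ⊢ t ⦂ T → Γ' ⊢ sub σ t ⦂ sub σ T
  ⊢-sub h (axiom ax) = ⊢-axiom (wf h) ax
  ⊢-sub h (start d)  = lookup h here
  ⊢-sub {σ = σ} h (weak {t = t} {T = T} d e) =
    subst₂ (_ ⊢_⦂_) (sym (sub-ren σ suc t)) (sym (sub-ren σ suc T)) (⊢-sub (⊩-tail h) d)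
  ⊢-sub h (prod r a b) = prod r a' (⊢-sub (⊩-exts h a') b)
    where a' = ⊢-sub h a
  ⊢-sub h (abs d e) with ⊢-sub h e
  ... | e' with gen-pi-domain e' refl
  ... | _ , a' = abs (⊢-sub (⊩-exts h a') d) e'
  ⊢-sub {σ = σ} h (appl {B = B} {u = u} d e) =
    subst (_ ⊢ _ ⦂_) (sym (sub-[0≔] σ B u)) (appl (⊢-sub h d) (⊢-sub h e))
  ⊢-sub {σ = σ} h (conv d e x) = conv (⊢-sub h d) (⊢-sub h e) (≡β-sub σ x)

  ⊢-ren : ∀ {Γ Γ' ρ t T} → Γ' ⊩ var ∘ ρ ⦂ Γ → Γ ⊢ t ⦂ T → Γ' ⊢ ren ρ t ⦂ ren ρ T
  ⊢-ren {ρ = ρ} {t} {T} h d = subst₂ (_ ⊢_⦂_) (sub-var∘ ρ t) (sub-var∘ ρ T) (⊢-sub h d)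

  ⊩-wk : ∀ {Γ A s} → Γ ⊢ A ⦂ const s → (A ∷ Γ) ⊩ var ∘ suc ⦂ Γ
  wf     (⊩-wk d) = wf-∷ d
  lookup (⊩-wk d) {T = T} l = subst (_ ⊢ _ ⦂_) (sym (sub-var∘ suc T)) (⊢-var (wf-∷ d) (there l))

  ⊩-ext : ∀ {Γ Γ' ρ A s} → Γ' ⊩ var ∘ ρ ⦂ Γ → Γ' ⊢ ren ρ A ⦂ const s →
          (ren ρ A ∷ Γ') ⊩ var ∘ ext {Sort} ρ ⦂ (A ∷ Γ)
  ⊩-ext {Γ' = Γ'} {ρ} {A} h d =
    ⊩-cong (exts-var∘ ρ)
      (subst (λ X → (X ∷ Γ') ⊩ exts (var ∘ ρ) ⦂ _) (sub-var∘ ρ A)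
        (⊩-exts h (subst (Γ' ⊢_⦂ const _) (sym (sub-var∘ ρ A)) d)))

  ⊩-[0≔] : ∀ {Γ u A} → Γ ⊢ u ⦂ A → Γ ⊩ subAt 0 u ⦂ (A ∷ Γ)
  wf     (⊩-[0≔] d) = ⊢⇒wf d
  lookup (⊩-[0≔] {u = u} {A} d) here = subst (_ ⊢ u ⦂_) (sym (ren-suc-[0≔] A u)) d
  lookup (⊩-[0≔] {u = u} d) (there {T = T} l) =
    subst (_ ⊢ _ ⦂_) (sym (ren-suc-[0≔] T u)) (⊢-var (⊢⇒wf d) l)

  ⊢-[0≔] : ∀ {Γ u A t T} → Γ ⊢ u ⦂ A → (A ∷ Γ) ⊢ t ⦂ T → Γ ⊢ (t [ 0 ≔ u ]) ⦂ (T [ 0 ≔ u ])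
  ⊢-[0≔] du = ⊢-sub (⊩-[0≔] du)

  ⊩-[≔] : ∀ Δ {Γ A u} → Γ ⊢ u ⦂ A → WellFormed (Δ ++ A ∷ Γ) →
          (substCtx P Δ u ++ Γ) ⊩ subAt (length Δ) u ⦂ (Δ ++ A ∷ Γ)
  ⊩-[≔] []      du _        = ⊩-[0≔] du
  ⊩-[≔] (D ∷ Δ) du (wf-∷ d) = ⊩-cong subAt-suc (⊩-exts h (⊢-sub h d))
    where
    h = ⊩-[≔] Δ du (⊢⇒wf d)
    subAt-suc : exts (subAt (length Δ) _) ≗ subAt (suc (length Δ)) _
    subAt-suc zero    = refl
    subAt-suc (suc i) = refl

  ⊩-conv : ∀ {Γ A A' s s'} → Γ ⊢ A ⦂ const s → Γ ⊢ A' ⦂ const s' → A' ≡β A →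
           (A' ∷ Γ) ⊩ var ⦂ (A ∷ Γ)
  wf     (⊩-conv dA dA' x) = wf-∷ dA'
  lookup (⊩-conv {A = A} dA dA' x) here =
    subst (_ ⊢ var 0 ⦂_) (sym (sub-var (ren suc A))) (conv (start dA') (weak dA dA') (≡β-ren suc x))
  lookup (⊩-conv dA dA' x) (there {T = T} l) =
    subst (_ ⊢ _ ⦂_) (sym (sub-var (ren suc T))) (⊢-var (wf-∷ dA') (there l))

  ⊢-ctx-conv : ∀ {Γ A A' s s' t T} → Γ ⊢ A ⦂ const s → Γ ⊢ A' ⦂ const s' → A' ≡β A →
               (A ∷ Γ) ⊢ t ⦂ T → (A' ∷ Γ) ⊢ t ⦂ T
  ⊢-ctx-conv {t = t} {T} dA dA' x d =
    subst₂ (_ ⊢_⦂_) (sub-var t) (sub-var T) (⊢-sub (⊩-conv dA dA' x) d)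

  gen-var : ∀ {Γ t T i} → Γ ⊢ t ⦂ T → t ≡ var i → ∃ λ T' → Γ ∋ i ⦂ T' × T ≡β T'
  gen-var (start d) refl = _ , here , ε
  gen-var (weak {t = var _} d e) refl with gen-var d refl
  ... | T' , l , x = _ , there l , ≡β-ren suc x
  gen-var (conv d e x) eq with gen-var d eq
  ... | T' , l , y = T' , l , ≡β-sym x ◅◅ y

  gen-sort : ∀ {Γ t T s} → Γ ⊢ t ⦂ T → t ≡ const s → ∃ λ s' → Axiom s s' × T ≡β const s'
  gen-sort (axiom ax) refl = _ , ax , ε
  gen-sort (weak {t = const _} d e) refl with gen-sort d refl
  ... | s' , ax , x = s' , ax , ≡β-ren suc x
  gen-sort (conv d e x) eq with gen-sort d eq
  ... | s' , ax , y = s' , ax , ≡β-sym x ◅◅ y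

  record GenPi (Γ : Ctx P) (A B T : PTerm P) : Set where
    constructor mkGenPi
    field
      {s₁ s₂ s₃} : Sort
      rule       : Rule s₁ s₂ s₃
      ⊢domain    : Γ ⊢ A ⦂ const s₁
      ⊢codomain  : (A ∷ Γ) ⊢ B ⦂ const s₂
      type≡β     : T ≡β const s₃

  gen-pi : ∀ {Γ t T A B} → Γ ⊢ t ⦂ T → t ≡ pi A B → GenPi Γ A B T
  gen-pi (weak {t = pi _ _} d e) refl with gen-pi d refl
  ... | mkGenPi r a b x =
    mkGenPi r (weak a e) (⊢-ren (⊩-ext (⊩-wk e) (weak a e)) b) (≡β-ren suc x)
  gen-pi (prod r a b) refl = mkGenPi r a b ε
  gen-pi (conv d e x) eq with gen-pi d eq
  ... | mkGenPi r a b y = mkGenPi r a b (≡β-sym x ◅◅ y)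

  record GenLam (Γ : Ctx P) (A t T : PTerm P) : Set where
    constructor mkGenLam
    field
      {B}      : PTerm P
      {s}      : Sort
      ⊢body    : (A ∷ Γ) ⊢ t ⦂ B
      ⊢pi      : Γ ⊢ pi A B ⦂ const s
      type≡β   : T ≡β pi A B

  gen-lam : ∀ {Γ t T A b} → Γ ⊢ t ⦂ T → t ≡ lam A b → GenLam Γ A b T
  gen-lam (weak {t = lam _ _} d e) refl with gen-lam d refl
  ... | mkGenLam db dp x with gen-pi-domain (weak dp e) refl
  ... | _ , dA = mkGenLam (⊢-ren (⊩-ext (⊩-wk e) dA) db) (weak dp e) (≡β-ren suc x)
  gen-lam (abs d e) refl = mkGenLam d e ε
  gen-lam (conv d e x) eq with gen-lam d eq
  ... | mkGenLam db dp y = mkGenLam db dp (≡β-sym x ◅◅ y)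

  record GenApp (Γ : Ctx P) (t u T : PTerm P) : Set where
    constructor mkGenApp
    field
      {A B}    : PTerm P
      ⊢fun     : Γ ⊢ t ⦂ pi A B
      ⊢arg     : Γ ⊢ u ⦂ A
      type≡β   : T ≡β (B [ 0 ≔ u ])

  gen-app : ∀ {Γ t T f u} → Γ ⊢ t ⦂ T → t ≡ app f u → GenApp Γ f u T
  gen-app (weak {t = app _ u} d e) refl with gen-app d refl
  ... | mkGenApp {B = B} df du x =
    mkGenApp (weak df e) (weak du e) (subst (_ ≡β_) (ren-[0≔] suc B u) (≡β-ren suc x))
  gen-app (appl d e) refl = mkGenApp d e ε
  gen-app (conv d e x) eq with gen-app d eq
  ... | mkGenApp df du y = mkGenApp df du (≡β-sym x ◅◅ y)

  types-sorted : ∀ {Γ t T} → Γ ⊢ t ⦂ T → (∃ λ s → T ≡ const s) ⊎ (∃ λ s → Γ ⊢ T ⦂ const s)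
  app-type-sorted : ∀ {Γ t A B u} → Γ ⊢ t ⦂ pi A B → Γ ⊢ u ⦂ A →
                    ∃ λ s → Γ ⊢ (B [ 0 ≔ u ]) ⦂ const s

  types-sorted (axiom _)    = inj₁ (_ , refl)
  types-sorted (start d)    = inj₂ (_ , weak d d)
  types-sorted (weak d e) with types-sorted d
  ... | inj₁ (_ , refl)     = inj₁ (_ , refl)
  ... | inj₂ (_ , d')       = inj₂ (_ , weak d' e)
  types-sorted (prod _ _ _) = inj₁ (_ , refl)
  types-sorted (abs _ e)    = inj₂ (_ , e)
  types-sorted (appl d e)   = inj₂ (app-type-sorted d e)
  types-sorted (conv _ e _) = inj₂ (_ , e)

  app-type-sorted d e with types-sorted d
  ... | inj₂ (_ , p) = _ , ⊢-[0≔] e (GenPi.⊢codomain (gen-pi p refl))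

  subject-reduction : ∀ {Γ t T t'} → Γ ⊢ t ⦂ T → t ⟶β t' → Γ ⊢ t' ⦂ T
  subject-reduction (weak {t = t} d e) r with ren-⟶β-inv suc t r
  ... | _ , r' , refl = weak (subject-reduction d r') e
  subject-reduction (prod x a b) (piˡ r) = prod x a' (⊢-ctx-conv a a' (≡β-sym (⟶β⇒≡β r)) b)
    where a' = subject-reduction a r
  subject-reduction (prod x a b) (piʳ r) = prod x a (subject-reduction b r)
  subject-reduction (abs d e) (lamˡ r) with subject-reduction e (piˡ r)
  ... | e' with gen-pi-domain e refl | gen-pi-domain e' refl
  ... | _ , dA | _ , dA' =
    conv (abs (⊢-ctx-conv dA dA' (≡β-sym (⟶β⇒≡β r)) d) e') e (pi-≡βˡ (≡β-sym (⟶β⇒≡β r)))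
  subject-reduction (abs d e) (lamʳ r) = abs (subject-reduction d r) e
  subject-reduction (appl d e) (appˡ r) = appl (subject-reduction d r) e
  subject-reduction (appl {B = B} d e) (appʳ r) with app-type-sorted d e
  ... | _ , dT = conv (appl d (subject-reduction e r)) dT ([0≔]-≡β B r)
  subject-reduction (appl {u = u} d e) β with gen-lam d refl
  ... | mkGenLam db dp x with pi-≡β-injective x | app-type-sorted d e | gen-pi-domain dp refl
  ... | xA , xB | _ , dT | _ , dA = conv (⊢-[0≔] (conv e dA xA) db) dT (≡β-sub (subAt 0 u) (≡β-sym xB))
  subject-reduction (conv d e x) r = conv (subject-reduction d r) e x

  module _ (functional : Functional P) where

    types-unique : ∀ {Γ} t {T T'} → Γ ⊢ t ⦂ T → Γ ⊢ t ⦂ T' → T ≡β T'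
    types-unique (var i) d d' with gen-var d refl | gen-var d' refl
    ... | _ , l , x | _ , l' , x' with ∋-functional l l'
    ... | refl = x ◅◅ ≡β-sym x'
    types-unique (const c) d d' with gen-sort d refl | gen-sort d' refl
    ... | _ , ax , x | _ , ax' , x' with proj₁ functional ax ax'
    ... | refl = x ◅◅ ≡β-sym x'
    types-unique (pi A B) d d' with gen-pi d refl | gen-pi d' refl
    ... | mkGenPi r a b x | mkGenPi r' a' b' x'
        with const-≡β-injective (types-unique A a a') | const-≡β-injective (types-unique B b b')
    ... | refl | refl with proj₂ functional r r'
    ... | refl = x ◅◅ ≡β-sym x'
    types-unique (lam A t) d d' with gen-lam d refl | gen-lam d' refl
    ... | mkGenLam db _ x | mkGenLam db' _ x' = x ◅◅ pi-≡βʳ (types-unique t db db') ◅◅ ≡β-sym x'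
    types-unique (app t u) d d' with gen-app d refl | gen-app d' refl
    ... | mkGenApp dt _ x | mkGenApp dt' _ x' =
      x ◅◅ ≡β-sub (subAt 0 u) (proj₂ (pi-≡β-injective (types-unique t dt dt'))) ◅◅ ≡β-sym x'

    sorts-unique : ∀ {Γ A s s'} → Γ ⊢ A ⦂ const s → Γ ⊢ A ⦂ const s' → s ≡ s'
    sorts-unique d d' = const-≡β-injective (types-unique _ d d')

module Translation (P : PTS) (functional : Functional P) where
  open PTS P
  open Metatheory P

  Tr-deterministic : ∀ {Γ t t' t''} → Tr P Γ t t' → Tr P Γ t t'' → t' ≡ t''
  Tr-deterministic tr-var tr-var   = refl
  Tr-deterministic tr-sort tr-sort = refl
  Tr-deterministic (tr-pi a b c tA tB) (tr-pi a' b' c' tA' tB')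
    with sorts-unique functional a a' | sorts-unique functional b b' | sorts-unique functional c c'
  ... | refl | refl | refl = cong₂ (λ A B → app (app _ A) (lam (app _ A) B))
                                   (Tr-deterministic tA tA') (Tr-deterministic tB tB')
  Tr-deterministic (tr-lam a tA tt) (tr-lam a' tA' tt') with sorts-unique functional a a'
  ... | refl = cong₂ (λ A t → lam (app _ A) t) (Tr-deterministic tA tA') (Tr-deterministic tt tt')
  Tr-deterministic (tr-app tt tu) (tr-app tt' tu') =
    cong₂ app (Tr-deterministic tt tt') (Tr-deterministic tu tu')

  typed-sort-has-axiom : ∀ {Γ s T} → Γ ⊢ const s ⦂ T → ∃ λ s' → Axiom s s'
  typed-sort-has-axiom d with gen-sort d refl
  ... | s' , ax , _ = s' , ax

  Tr₂-deterministic : ∀ {Γ A A' A''} → Tr₂ P Γ A A' → Tr₂ P Γ A A'' → A' ≡ A''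
  Tr₂-deterministic (tr₂-typ d tr) (tr₂-typ d' tr') with sorts-unique functional d d'
  ... | refl = cong (app _) (Tr-deterministic tr tr')
  Tr₂-deterministic (tr₂-typ d _) (tr₂-top ¬ax) = ⊥-elim (¬ax (typed-sort-has-axiom d))
  Tr₂-deterministic (tr₂-top ¬ax) (tr₂-typ d _) = ⊥-elim (¬ax (typed-sort-has-axiom d))
  Tr₂-deterministic (tr₂-top _) (tr₂-top _)     = refl

  Tr-ren : ∀ {Γ Γ' ρ t t'} → Γ' ⊩ var ∘ ρ ⦂ Γ → Tr P Γ t t' → Tr P Γ' (ren ρ t) (ren ρ t')
  Tr-ren h tr-var  = tr-var
  Tr-ren h tr-sort = tr-sort
  Tr-ren h (tr-pi a b c tA tB) =
    tr-pi a' (⊢-ren (⊩-ext h a') b) (⊢-ren h c) (Tr-ren h tA) (Tr-ren (⊩-ext h a') tB)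
    where a' = ⊢-ren h a
  Tr-ren h (tr-lam a tA tt) = tr-lam a' (Tr-ren h tA) (Tr-ren (⊩-ext h a') tt)
    where a' = ⊢-ren h a
  Tr-ren h (tr-app tt tu) = tr-app (Tr-ren h tt) (Tr-ren h tu)

  Tr-exts : ∀ {Γ σ σ' A s} → (∀ i → Tr P Γ (σ i) (σ' i)) → Γ ⊢ A ⦂ const s →
            ∀ i → Tr P (A ∷ Γ) (exts σ i) (exts σ' i)
  Tr-exts q d zero    = tr-var
  Tr-exts q d (suc i) = Tr-ren (⊩-wk d) (q i)

  Tr-sub : ∀ {Γ Γ' σ σ' t t'} → Γ' ⊩ σ ⦂ Γ → (∀ i → Tr P Γ' (σ i) (σ' i)) →
           Tr P Γ t t' → Tr P Γ' (sub σ t) (sub σ' t')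
  Tr-sub h q tr-var  = q _
  Tr-sub h q tr-sort = tr-sort
  Tr-sub h q (tr-pi a b c tA tB) =
    tr-pi a' (⊢-sub (⊩-exts h a') b) (⊢-sub h c) (Tr-sub h q tA) (Tr-sub (⊩-exts h a') (Tr-exts q a') tB)
    where a' = ⊢-sub h a
  Tr-sub h q (tr-lam a tA tt) = tr-lam a' (Tr-sub h q tA) (Tr-sub (⊩-exts h a') (Tr-exts q a') tt)
    where a' = ⊢-sub h a
  Tr-sub h q (tr-app tt tu) = tr-app (Tr-sub h q tt) (Tr-sub h q tu)

  Tr-ctx-conv : ∀ {Γ A A' s s' t t'} → Γ ⊢ A ⦂ const s → Γ ⊢ A' ⦂ const s' → A' ≡β A →
                Tr P (A ∷ Γ) t t' → Tr P (A' ∷ Γ) t t'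
  Tr-ctx-conv {Γ} {A' = A'} {t = t} {t'} dA dA' x tr =
    subst₂ (Tr P (A' ∷ Γ)) (sub-var t) (sub-var t') (Tr-sub (⊩-conv dA dA' x) (λ _ → tr-var) tr)

  Tr-subAt : ∀ Δ {Γ A u u'} → Γ ⊢ u ⦂ A → Tr P Γ u u' → WellFormed (Δ ++ A ∷ Γ) →
             ∀ i → Tr P (substCtx P Δ u ++ Γ) (subAt (length Δ) u i) (subAt (length Δ) u' i)
  Tr-subAt []      du tu _        zero    = tu
  Tr-subAt []      du tu _        (suc i) = tr-var
  Tr-subAt (D ∷ Δ) du tu (wf-∷ d) zero    = tr-var
  Tr-subAt (D ∷ Δ) du tu (wf-∷ d) (suc i) =
    Tr-ren (⊩-wk (⊢-sub (⊩-[≔] Δ du (⊢⇒wf d)) d)) (Tr-subAt Δ du tu (⊢⇒wf d) i)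

  Tr-[≔] : ∀ Δ {Γ A t t' u u'} → Γ ⊢ u ⦂ A → Tr P Γ u u' → WellFormed (Δ ++ A ∷ Γ) →
           Tr P (Δ ++ A ∷ Γ) t t' →
           Tr P (substCtx P Δ u ++ Γ) (t [ length Δ ≔ u ]) (t' [ length Δ ≔ u' ])
  Tr-[≔] Δ du tu w = Tr-sub (⊩-[≔] Δ du w) (Tr-subAt Δ du tu w)

  Tr₂-[≔] : ∀ Δ {Γ A t t' u u'} → Γ ⊢ u ⦂ A → Tr P Γ u u' →
            Tr₂ P (Δ ++ A ∷ Γ) t t' →
            Tr₂ P (substCtx P Δ u ++ Γ) (t [ length Δ ≔ u ]) (t' [ length Δ ≔ u' ])
  Tr₂-[≔] Δ du tu (tr₂-typ d tr) =
    tr₂-typ (⊢-sub (⊩-[≔] Δ du (⊢⇒wf d)) d) (Tr-[≔] Δ du tu (⊢⇒wf d) tr)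
  Tr₂-[≔] Δ du tu (tr₂-top ¬ax) = tr₂-top ¬ax

  -- |A| occurs twice in |Π x:A. B|, so a step inside A costs two steps of the translation.
  Tr-⟶β : ∀ {Γ t T u t'} → Γ ⊢ t ⦂ T → t ⟶β u → Tr P Γ t t' →
          ∃ λ u' → Tr P Γ u u' × t' ⟶β⁺ u'
  Tr-⟶β d β (tr-app (tr-lam a _ tt) tu) with gen-app d refl
  ... | mkGenApp df du _ with gen-lam df refl
  ... | mkGenLam _ _ x =
    _ , Tr-[≔] [] (conv du a (proj₁ (pi-≡β-injective x))) tu (wf-∷ a) tt , [ β ]
  Tr-⟶β d (piˡ r) (tr-pi {s₁ = s₁} {s₂} {s₃} a b c tA tB) with Tr-⟶β a r tA
  ... | A₂ , tA₂ , rs =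
    _ , tr-pi a₂ (⊢-ctx-conv a a₂ back b) (subject-reduction c (piˡ r)) tA₂ (Tr-ctx-conv a a₂ back tB) ,
    (⟶β⁺-map (λ X → app (app (const (dotΠ s₁ s₂ s₃)) X) _) (appˡ ∘ appʳ) rs ⁺++⁺
     ⟶β⁺-map (λ X → app (app (const (dotΠ s₁ s₂ s₃)) A₂) (lam (app (const (ε s₁)) X) _))
             (appʳ ∘ lamˡ ∘ appʳ) rs)
    where
    a₂   = subject-reduction a r
    back = ≡β-sym (⟶β⇒≡β r)
  Tr-⟶β d (piʳ r) (tr-pi a b c tA tB) with Tr-⟶β b r tB
  ... | _ , tB₂ , rs =
    _ , tr-pi a (subject-reduction b r) (subject-reduction c (piʳ r)) tA tB₂ ,
    ⟶β⁺-map (app _ ∘ lam _) (appʳ ∘ lamʳ) rs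
  Tr-⟶β d (lamˡ r) (tr-lam a tA tt) with Tr-⟶β a r tA
  ... | _ , tA₂ , rs =
    _ , tr-lam a₂ tA₂ (Tr-ctx-conv a a₂ (≡β-sym (⟶β⇒≡β r)) tt) ,
    ⟶β⁺-map (λ X → lam (app _ X) _) (lamˡ ∘ appʳ) rs
    where a₂ = subject-reduction a r
  Tr-⟶β d (lamʳ r) (tr-lam a tA tt) with Tr-⟶β (GenLam.⊢body (gen-lam d refl)) r tt
  ... | _ , tt₂ , rs = _ , tr-lam a tA tt₂ , ⟶β⁺-map (lam _) lamʳ rs
  Tr-⟶β d (appˡ r) (tr-app tt tu) with Tr-⟶β (GenApp.⊢fun (gen-app d refl)) r tt
  ... | _ , tt₂ , rs = _ , tr-app tt₂ tu , ⟶β⁺-map (λ X → app X _) appˡ rs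
  Tr-⟶β d (appʳ r) (tr-app tt tu) with Tr-⟶β (GenApp.⊢arg (gen-app d refl)) r tu
  ... | _ , tu₂ , rs = _ , tr-app tt tu₂ , ⟶β⁺-map (app _) appʳ rs

proposition1 : (P : PTS) → Functional P →
    (∀ (Γ Δ : Ctx P) (A t u : PTerm P) → _⊢_∶_ P Γ u A →
      (∀ (T : PTerm P) t₁ u₁ t₂ → _⊢_∶_ P (Δ ++ A ∷ Γ) t T →
         Tr P (Δ ++ A ∷ Γ) t t₁ → Tr P Γ u u₁ →
         Tr P (substCtx P Δ u ++ Γ) (t [ length Δ ≔ u ]) t₂ →
         t₂ ≡ (t₁ [ length Δ ≔ u₁ ]))
      ×
      (∀ t₁ u₁ t₂ → Tr₂ P (Δ ++ A ∷ Γ) t t₁ → Tr P Γ u u₁ →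
         Tr₂ P (substCtx P Δ u ++ Γ) (t [ length Δ ≔ u ]) t₂ →
         t₂ ≡ (t₁ [ length Δ ≔ u₁ ])))
    ×
    (∀ (Γ : Ctx P) (t T u : PTerm P) (t' u' : LTerm P) →
      _⊢_∶_ P Γ t T → t ⟶β u → Tr P Γ t t' → Tr P Γ u u' →
      t' ⟶β⁺ u')
proposition1 P functional =
    (λ Γ Δ A t u du →
        (λ T t₁ u₁ t₂ dt tt tu tt[u] → Tr-deterministic tt[u] (Tr-[≔] Δ du tu (⊢⇒wf dt) tt))
      , (λ t₁ u₁ t₂ tt tu tt[u] → Tr₂-deterministic tt[u] (Tr₂-[≔] Δ du tu tt)))
  , (λ Γ t T u t' u' dt r tt tu →
        let _ , tu' , rs = Tr-⟶β dt r tt in subst (t' ⟶β⁺_) (Tr-deterministic tu' tu) rs)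
  where
  open Metatheory P
  open Translation P functional
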